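{- Let $\Pi$ be a finite set of proposition symbols and $\Delta\in\mathbb{N}$. Given a $\Pi$-program of $\mathrm{MPMSC}$ of size $m$, one can construct a message passing circuit (MPC) for $(\Pi,\Delta)$ of size $\mathcal{O}(\Delta m+|\Pi|)$ that is strongly equivalent to the program.
   Context: Proposition symbols: a countably infinite, linearly ordered set partitioned into ordinary and identifier symbols; for finite $\Pi$, $\Pi_1$ denotes its identifier symbols. A Kripke model over $\Pi$ is $M=(W,R,V)$, $W\ne\emptyset$, $R\subseteq W\times W$, $V:\Pi\to\mathcal P(W)$. With $p_1,\dots,p_\ell$ listing $\Pi_1$ in order, $\mathrm{ID}(w)$ is the $\ell$-bit string whose $i$th bit is $1$ iff $w\in V(p_i)$; $M$ has identifiers if $\mathrm{ID}$ is injective. The local input of $w$ is the $|\Pi|$-bit string recording which symbols of $\Pi$ (in order) hold at $w$. $\mathcal K(\Pi,\Delta)$: finite Kripke models over $\Pi$ with identifiers and out-degree at most $\Delta$. If the successors of $w$ have identifiers $s_1<\dots<s_d$ lexicographically, the one with identifier $s_i$ is the $i$th neighbour of $w$. Sequences: for a sequence $(\overline b_n)_n$ of $k$-bit strings and $A,P\subseteq[k]$, the appointed string of round $n$ is the substring of $\overline b_n$ at positions $A\cup P$. Circuits: a Boolean circuit is a DAG with gates labelled $\wedge,\vee$ (any fan-in) or $\neg$ (fan-in 1) except input gates; inputs and outputs are linearly ordered; size = number of gates. An MPC for $(\Pi,\Delta)$ is a circuit computing $\{0,1\}^{|\Pi|+k(\Delta+1)}\to\{0,1\}^k$ with attention and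 print bit sets $A,P\subseteq[k]$. On $M\in\mathcal K(\Pi,\Delta)$: $f_0(w)=C(\overline t_w\cdot0^{k(\Delta+1)})$ with $\overline t_w$ the local input, $f_{n+1}(w)=C(\overline t_w\cdot f_n(w)\cdot f_n(v_1)\cdots f_n(v_m)\cdot(0^k)^{\Delta-m})$, $v_1,\dots,v_m$ the neighbours of $w$ in order. Its appointed string at $w$ in round $n$ is that of $(f_n(w))_n$ w.r.t. $(k,A,P)$. MPMSC: schemata are built by $\varphi::=\top\mid p\mid X\mid\neg\varphi\mid(\varphi\wedge\varphi)\mid\Diamond_i\varphi$ ($p\in\Pi$, $X$ a schema variable, $i\in\mathbb Z_+$), where $\Diamond_i\varphi$ holds at $w$ iff $w$ has an $i$th neighbour and $\varphi$ holds there. A $\Pi$-program of MPMSC has distinct head predicates $Y_1,\dots,Y_k$ (fixed order), a terminal clause $Y_i(0):=\varphi_i$ for each $i$ with $\varphi_i$ diamond- and variable-free, and for each $i$ an iteration clause, either standard $Y_i:=\psi$ or conditional $Y_i:=_{\varphi_1,\dots,\varphi_n}\psi_1;\dots;\psi_n;\chi$, where conditions have modal depth $0$ and $\psi,\psi_j,\chi$ have modal depth at most $1$ (schemata over $\{Y_1,\dots,Y_k\}$); plus sets of attention and print predicates among the heads. Semantics: $Y_i^0=\varphi_i$; for a standard clause $Y_i^{n+1}=\psi^{n+1}$; for a conditional clause $Y_i^{n+1}=\bigvee_{j\le n}\big(\bigwedge_{j'<j}\neg\varphi_{j'}^{n+1}\wedge\varphi_j^{n+1}\wedge\psi_j^{n+1}\big)\vee\big(\bigwedge_{j\le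 n}\neg\varphi_j^{n+1}\wedge\chi^{n+1}\big)$, where $\theta^{n+1}$ is $\theta$ with each $Y_j$ replaced by $Y_j^n$. The round-$n$ configuration at $w$ is the $k$-bit string with $i$th bit $1$ iff $(M,w)\models Y_i^n$, and the appointed string of round $n$ is its restriction to positions of attention/print predicates. Size = number of occurrences of proposition symbols, head predicates, $\top,\neg,\wedge,\Diamond_i$. Strong equivalence: a program and an MPC for $(\Pi,\Delta)$ are strongly equivalent if for every $M\in\mathcal K(\Pi,\Delta)$ interpreting all symbols of the program, every node $w$ and every round $n$, they produce the same appointed string at $w$ in round $n$. -}

module Defs where

open import Data.Bool using (Bool; true; false; if_then_else_; not; _∧_; _∨_)
open import Data.Nat using (ℕ; zero; suc; _+_; _*_; _≤_; _<_)
open import Data.Fin using (Fin)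
open import Data.List as L using (List; []; _∷_; length; filterᵇ; allFin)
open import Data.List.NonEmpty using (List⁺)
import Data.List.NonEmpty as L⁺
open import Data.Vec as V using (Vec; []; _∷_; _++_; lookup; tabulate; replicate; concat)
open import Data.Maybe using (Maybe; just; nothing)
open import Data.Product using (_×_; _,_; Σ)
open import Data.Fin.Subset using (Subset; _∪_)
open import Relation.Binary.PropositionalEquality using (_≡_)

lexLeq : List Bool → List Bool → Bool
lexLeq [] _ = true
lexLeq (_ ∷ _) [] = false
lexLeq (false ∷ xs) (true ∷ ys) = true
lexLeq (true ∷ xs) (false ∷ ys) = false
lexLeq (false ∷ xs) (false ∷ ys) = lexLeq xs ys
lexLeq (true ∷ xs) (true ∷ ys) = lexLeq xs ys

insertBy : {A : Set} → (A → List Bool) → A → List A → List A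
insertBy key x [] = x ∷ []
insertBy key x (y ∷ ys) =
  if lexLeq (key x) (key y) then x ∷ y ∷ ys else y ∷ insertBy key x ys

sortBy : {A : Set} → (A → List Bool) → List A → List A
sortBy key = L.foldr (insertBy key) []

pad : {A : Set} → (d : ℕ) → A → List A → Vec A d
pad zero z _ = []
pad (suc d) z [] = z ∷ pad d z []
pad (suc d) z (x ∷ xs) = x ∷ pad d z xs

nth : {A : Set} → List A → ℕ → Maybe A
nth [] _ = nothing
nth (x ∷ xs) zero = just x
nth (x ∷ xs) (suc i) = nth xs i

restrict : {k : ℕ} → Vec Bool k → Subset k → List Bool
restrict [] [] = []
restrict (b ∷ bs) (true ∷ s) = b ∷ restrict bs s
restrict (b ∷ bs) (false ∷ s) = restrict bs s

-- Proposition symbols: ℕ (linearly ordered by ≤), partitioned by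
-- isId : ℕ → Bool into identifier (true) and ordinary (false) symbols.
-- A finite set Π of symbols is a strictly increasing list of naturals;
-- a symbol of Π is referred to by its position Fin (length Π).

identifierPositions : (isId : ℕ → Bool) (Π : List ℕ) → List (Fin (length Π))
identifierPositions isId Π = filterᵇ (λ i → isId (L.lookup Π i)) (allFin (length Π))

record Kripke (Π : List ℕ) : Set where
  field
    size : ℕ
    R    : Fin (suc size) → Fin (suc size) → Bool
    V    : Fin (length Π) → Fin (suc size) → Bool

W : {Π : List ℕ} → Kripke Π → Set
W M = Fin (suc (Kripke.size M))

module _ (isId : ℕ → Bool) {Π : List ℕ} (M : Kripke Π) where
  open Kripke M

  ID : W M → List Bool
  ID w = L.map (λ i → V i w) (identifierPositions isId Π)

  HasIdentifiers : Set
  HasIdentifiers = ∀ u v → ID u ≡ ID v → u ≡ v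

  successors : W M → List (W M)
  successors w = filterᵇ (R w) (allFin (suc size))

  -- successors ordered lexicographically by identifier:
  -- the i-th element (0-based) is the (i+1)-th neighbour
  neighbours : W M → List (W M)
  neighbours w = sortBy ID (successors w)

  localInput : W M → Vec Bool (length Π)
  localInput w = tabulate (λ i → V i w)

InK : (isId : ℕ → Bool) (Π : List ℕ) (Δ : ℕ) → Kripke Π → Set
InK isId Π Δ M =
  HasIdentifiers isId M × (∀ w → length (successors isId M w) ≤ Δ)

-- Boolean circuits.  Wires are numbered; a circuit starts with its
-- input gates and adds gates one at a time, each reading only wires that
-- already exist (a topological ordering of the DAG).

data Gate (c : ℕ) : Set where
  andG : List (Fin c) → Gate c
  orG  : List (Fin c) → Gate c
  notG : Fin c → Gate c

data Gates : ℕ → ℕ → Set where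
  done : ∀ {c} → Gates c c
  _▹_  : ∀ {c d} → Gate c → Gates (suc c) d → Gates c d

evalGate : ∀ {c} → Gate c → Vec Bool c → Bool
evalGate (andG is) v = L.foldr (λ i b → lookup v i ∧ b) true is
evalGate (orG is) v = L.foldr (λ i b → lookup v i ∨ b) false is
evalGate (notG i) v = not (lookup v i)

evalGates : ∀ {c d} → Gates c d → Vec Bool c → Vec Bool d
evalGates done v = v
evalGates (g ▹ gs) v = evalGates gs (evalGate g v ∷ v)

record Circuit (nIn nOut : ℕ) : Set where
  field
    wires   : ℕ                      -- total number of gates (incl. inputs)
    gates   : Gates nIn wires
    outputs : Vec (Fin wires) nOut

circuitSize : ∀ {n k} → Circuit n k → ℕ
circuitSize C = Circuit.wires C

evalCircuit : ∀ {n k} → Circuit n k → Vec Bool n → Vec Bool k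
evalCircuit C x = V.map (lookup (evalGates (Circuit.gates C) x)) (Circuit.outputs C)

record MPC (Π : List ℕ) (Δ : ℕ) : Set where
  field
    k   : ℕ
    C   : Circuit (length Π + suc Δ * k) k
    A   : Subset k
    P   : Subset k

module _ (isId : ℕ → Bool) {Π : List ℕ} {Δ : ℕ} (N : MPC Π Δ) (M : Kripke Π) where
  open MPC N

  mpcState : ℕ → W M → Vec Bool k
  mpcState zero w = evalCircuit C (localInput isId M w ++ replicate (suc Δ * k) false)
  mpcState (suc n) w =
    evalCircuit C (localInput isId M w ++ (mpcState n w ++
      concat (pad Δ (replicate k false) (L.map (mpcState n) (neighbours isId M w)))))

  mpcAppointed : ℕ → W M → List Bool
  mpcAppointed n w = restrict (mpcState n w) (A ∪ P)

-- MPMSC schemata over p proposition symbols and k schema variables.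
-- ◇ i φ stands for ◇_{i+1} φ (i+1 ∈ ℤ₊).

data Schema (p k : ℕ) : Set where
  ⊤ˢ   : Schema p k
  prop : Fin p → Schema p k
  var  : Fin k → Schema p k
  ¬ˢ   : Schema p k → Schema p k
  _∧ˢ_ : Schema p k → Schema p k → Schema p k
  ◇    : ℕ → Schema p k → Schema p k

modalDepth : ∀ {p k} → Schema p k → ℕ
modalDepth ⊤ˢ = 0
modalDepth (prop _) = 0
modalDepth (var _) = 0
modalDepth (¬ˢ φ) = modalDepth φ
modalDepth (φ ∧ˢ ψ) = modalDepth φ Data.Nat.⊔ modalDepth ψ
modalDepth (◇ _ φ) = suc (modalDepth φ)

schemaSize : ∀ {p k} → Schema p k → ℕ
schemaSize ⊤ˢ = 1
schemaSize (prop _) = 1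
schemaSize (var _) = 1
schemaSize (¬ˢ φ) = suc (schemaSize φ)
schemaSize (φ ∧ˢ ψ) = suc (schemaSize φ + schemaSize ψ)
schemaSize (◇ _ φ) = suc (schemaSize φ)

-- iteration clauses: standard Y := ψ, or conditional
-- Y :=_{φ₁..φₙ} ψ₁;..;ψₙ;χ given as the nonempty list of pairs (φⱼ,ψⱼ) and χ
data Clause (p k : ℕ) : Set where
  std  : Schema p k → Clause p k
  cond : List⁺ (Schema p k × Schema p k) → Schema p k → Clause p k

WFClause : ∀ {p k} → Clause p k → Set
WFClause (std ψ) = modalDepth ψ ≤ 1
WFClause (cond cs χ) =
  L.foldr (λ { (φ , ψ) S → (modalDepth φ ≡ 0 × modalDepth ψ ≤ 1) × S })
          (modalDepth χ ≤ 1) (L⁺.toList cs)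

clauseSize : ∀ {p k} → Clause p k → ℕ
clauseSize (std ψ) = schemaSize ψ
clauseSize (cond cs χ) =
  L.foldr (λ { (φ , ψ) s → schemaSize φ + schemaSize ψ + s }) (schemaSize χ) (L⁺.toList cs)

record Program (p : ℕ) : Set where
  field
    k         : ℕ
    terminal  : Vec (Schema p 0) k
    iteration : Vec (Clause p k) k
    attention : Subset k
    print     : Subset k
    terminalWF  : ∀ i → modalDepth (lookup terminal i) ≡ 0
    iterationWF : ∀ i → WFClause (lookup iteration i)

-- size: every head-predicate occurrence (clause heads included) counts 1
programSize : ∀ {p} → Program p → ℕ
programSize P =
  L.foldr _+_ 0 (L.map (λ φ → suc (schemaSize φ)) (V.toList (Program.terminal P)))
  + L.foldr _+_ 0 (L.map (λ c → suc (clauseSize c)) (V.toList (Program.iteration P)))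

module _ (isId : ℕ → Bool) {Π : List ℕ} (M : Kripke Π) where
  open Kripke M

  holds : ∀ {k} → (W M → Fin k → Bool) → Schema (length Π) k → W M → Bool
  holds env ⊤ˢ w = true
  holds env (prop i) w = V i w
  holds env (var j) w = env w j
  holds env (¬ˢ φ) w = not (holds env φ w)
  holds env (φ ∧ˢ ψ) w = holds env φ w ∧ holds env ψ w
  holds env (◇ i φ) w with nth (neighbours isId M w) i
  ... | nothing = false
  ... | just v = holds env φ v

  holdsCond : ∀ {k} → (W M → Fin k → Bool) → List (Schema (length Π) k × Schema (length Π) k)
            → Schema (length Π) k → W M → Bool
  holdsCond env [] χ w = holds env χ w
  holdsCond env ((φ , ψ) ∷ cs) χ w =
    if holds env φ w then holds env ψ w else holdsCond env cs χ w

  holdsClause : ∀ {k} → (W M → Fin k → Bool) → Clause (length Π) k → W M → Bool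
  holdsClause env (std ψ) w = holds env ψ w
  holdsClause env (cond cs χ) w = holdsCond env (L⁺.toList cs) χ w

  noVars : W M → Fin 0 → Bool
  noVars _ ()

  module _ (P : Program (length Π)) where
    open Program P

    config : ℕ → W M → Fin k → Bool
    config zero w i = holds noVars (lookup terminal i) w
    config (suc n) w i = holdsClause config′ (lookup iteration i) w
      where config′ = config n

    progAppointed : ℕ → W M → List Bool
    progAppointed n w = restrict (tabulate (config n w)) (attention ∪ print)

StronglyEquivalent : (isId : ℕ → Bool) (Π : List ℕ) (Δ : ℕ)
                   → Program (length Π) → MPC Π Δ → Set
StronglyEquivalent isId Π Δ P N =
  (M : Kripke Π) → InK isId Π Δ M → (w : W M) (n : ℕ) →
  progAppointed isId M P n w ≡ mpcAppointed isId N M n w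

module Submission where

-- Every node sends the same kind of message: for each head predicate Y_i its current truth value and a
-- flag, plus copies of the proposition symbols that iteration clauses read at neighbours.  The flags are
-- 0 in round 0, when the circuit sees only zeros, and 1 afterwards; they select between the terminal and
-- the iteration clause of Y_i, and they make ◇_d φ false when the node has no d-th neighbour, whose slot
-- is padded with zeros.  Each clause thus becomes a Boolean formula over the local input and the Δ+1
-- received messages (a conditional clause is a chain of if-then-else), with size linear in the clause.
-- Formulas compile into circuits with one gate per connective, and the message width is at most the
-- program size m, so the circuit has size O(Δ m + |Π|).

open import Defs
open import Data.Bool using (Bool; true; false; not; _∧_; _∨_; if_then_else_)
open import Data.Bool.Properties using (∧-identityʳ)
open import Data.Empty using (⊥-elim)
open import Data.Fin using (Fin; zero; suc; fromℕ<; _↑ˡ_; _↑ʳ_; combine)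
open import Data.Fin.Subset using (Subset; ⊥; _∪_)
open import Data.Fin.Subset.Properties using (∪-identityʳ)
open import Data.List as L using (List; []; _∷_; length; _++_)
open import Data.List.Membership.Propositional using (_∈_)
import Data.List.NonEmpty as L⁺
import Data.List.Properties as LP
open import Data.List.Relation.Binary.Subset.Propositional using (_⊆_)
open import Data.List.Relation.Binary.Subset.Propositional.Properties using (xs⊆xs++ys; xs⊆ys++xs; ⊆-trans)
open import Data.List.Relation.Unary.Any using (here; index)
open import Data.List.Relation.Unary.Any.Properties using (lookup-index)
open import Data.List.Relation.Unary.Linked using (Linked)
open import Data.Maybe using (just; nothing; maybe′)
open import Data.Nat using (ℕ; zero; suc; _+_; _*_; _≤_; _<_; z≤n; s≤s; s≤s⁻¹; _<?_)
open import Data.Nat.Properties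
open import Algebra.Properties.CommutativeMonoid.Sum +-0-commutativeMonoid using (sum; sum-syntax; ∑-distrib-+; sum-replicate-zero)
open import Algebra.Properties.Semiring.Sum +-*-semiring using (*-distribˡ-sum)
open import Data.Nat.Tactic.RingSolver using (solve-∀)
open import Data.Product using (Σ; _×_; _,_)
open import Data.Vec as V using (Vec; []; _∷_; lookup; tabulate; replicate; concat)
import Data.Vec.Properties as VP
open import Function using (_∘_)
open import Relation.Nullary using (Dec; yes; no)
open import Relation.Binary.PropositionalEquality

-- Boolean formulas and their circuits

data Formula (X : Set) : Set where
  input : X → Formula X
  ⊤ᶠ    : Formula X
  ¬ᶠ_   : Formula X → Formula X
  _∧ᶠ_  : Formula X → Formula X → Formula X

infix  6 ¬ᶠ_
infixr 5 _∧ᶠ_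

module _ {X : Set} where

  ⟦_⟧ : Formula X → (X → Bool) → Bool
  ⟦ input x ⟧ ρ = ρ x
  ⟦ ⊤ᶠ ⟧      ρ = true
  ⟦ ¬ᶠ a ⟧    ρ = not (⟦ a ⟧ ρ)
  ⟦ a ∧ᶠ b ⟧  ρ = ⟦ a ⟧ ρ ∧ ⟦ b ⟧ ρ

  -- inputs are wires of the circuit already, so they cost nothing
  formulaSize : Formula X → ℕ
  formulaSize (input _) = 0
  formulaSize ⊤ᶠ        = 1
  formulaSize (¬ᶠ a)    = suc (formulaSize a)
  formulaSize (a ∧ᶠ b)  = suc (formulaSize a + formulaSize b)

  totalSize : ∀ {n} → Vec (Formula X) n → ℕ
  totalSize as = V.sum (V.map formulaSize as)

  totalSize-++ : ∀ {m n} (as : Vec (Formula X) m) (bs : Vec (Formula X) n) →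
                 totalSize (as V.++ bs) ≡ totalSize as + totalSize bs
  totalSize-++ as bs = trans (cong V.sum (VP.map-++ formulaSize as bs)) (VP.sum-++ (V.map formulaSize as))

  totalSize-tabulate : ∀ {n} (f : Fin n → Formula X) → totalSize (tabulate f) ≡ ∑[ i < n ] formulaSize (f i)
  totalSize-tabulate {zero}  f = refl
  totalSize-tabulate {suc n} f = cong (formulaSize (f zero) +_) (totalSize-tabulate (f ∘ suc))

  ⟦⟧-cong : ∀ a {ρ σ : X → Bool} → (∀ x → ρ x ≡ σ x) → ⟦ a ⟧ ρ ≡ ⟦ a ⟧ σ
  ⟦⟧-cong (input x) ρ≗σ = ρ≗σ x
  ⟦⟧-cong ⊤ᶠ        ρ≗σ = refl
  ⟦⟧-cong (¬ᶠ a)    ρ≗σ = cong not (⟦⟧-cong a ρ≗σ)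
  ⟦⟧-cong (a ∧ᶠ b)  ρ≗σ = cong₂ _∧_ (⟦⟧-cong a ρ≗σ) (⟦⟧-cong b ρ≗σ)

  ⊥ᶠ : Formula X
  ⊥ᶠ = ¬ᶠ ⊤ᶠ

  infixr 4 _∨ᶠ_

  _∨ᶠ_ : Formula X → Formula X → Formula X
  a ∨ᶠ b = ¬ᶠ (¬ᶠ a ∧ᶠ ¬ᶠ b)

  ifᶠ_then_else_ : Formula X → Formula X → Formula X → Formula X
  ifᶠ a then b else c = (a ∧ᶠ b) ∨ᶠ (¬ᶠ a ∧ᶠ c)

  ⟦ifᶠ⟧ : ∀ a b c (ρ : X → Bool) {x y z} → ⟦ a ⟧ ρ ≡ x → ⟦ b ⟧ ρ ≡ y → ⟦ c ⟧ ρ ≡ z →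
          ⟦ ifᶠ a then b else c ⟧ ρ ≡ (if x then y else z)
  ⟦ifᶠ⟧ a b c ρ refl refl refl with ⟦ a ⟧ ρ | ⟦ b ⟧ ρ | ⟦ c ⟧ ρ
  ... | true  | true  | _     = refl
  ... | true  | false | _     = refl
  ... | false | _     | true  = refl
  ... | false | _     | false = refl

  formulaSize-ifᶠ : ∀ a b c → formulaSize (ifᶠ a then b else c)
                    ≡ 7 + 2 * formulaSize a + formulaSize b + formulaSize c
  formulaSize-ifᶠ a b c = normalise (formulaSize a) (formulaSize b) (formulaSize c)
    where
    normalise : ∀ x y z → suc (suc (suc (suc (x + y)) + suc (suc (suc x + z)))) ≡ 7 + 2 * x + y + z
    normalise = solve-∀

  formulaSize-ifᶠ≤ : ∀ a b c {A B C} → 1 ≤ A →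
                     formulaSize a ≤ A → formulaSize b ≤ B → formulaSize c ≤ 9 * C →
                     formulaSize (ifᶠ a then b else c) ≤ 9 * (A + B + C)
  formulaSize-ifᶠ≤ a b c {A} {B} {C} 1≤A a≤ b≤ c≤ = begin
    formulaSize (ifᶠ a then b else c)                      ≡⟨ formulaSize-ifᶠ a b c ⟩
    7 + 2 * formulaSize a + formulaSize b + formulaSize c
      ≤⟨ +-mono-≤ (+-mono-≤ (+-mono-≤ (*-monoʳ-≤ 7 1≤A) (*-monoʳ-≤ 2 a≤)) b≤) c≤ ⟩
    7 * A + 2 * A + B + 9 * C                              ≤⟨ m≤m+n _ (8 * B) ⟩
    7 * A + 2 * A + B + 9 * C + 8 * B                      ≡⟨ normalise A B C ⟩
    9 * (A + B + C)                                        ∎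
    where
    open ≤-Reasoning
    normalise : ∀ A B C → 7 * A + 2 * A + B + 9 * C + 8 * B ≡ 9 * (A + B + C)
    normalise = solve-∀

liftWire : ∀ {c d} → Gates c d → Fin c → Fin d
liftWire done     i = i
liftWire (_ ▹ gs) i = liftWire gs (suc i)

lookup-liftWire : ∀ {c d} (gs : Gates c d) (v : Vec Bool c) i →
                  lookup (evalGates gs v) (liftWire gs i) ≡ lookup v i
lookup-liftWire done     v i = refl
lookup-liftWire (g ▹ gs) v i = lookup-liftWire gs (evalGate g v ∷ v) (suc i)

infixr 5 _++ᵍ_

_++ᵍ_ : ∀ {a b c} → Gates a b → Gates b c → Gates a c
done     ++ᵍ hs = hs
(g ▹ gs) ++ᵍ hs = g ▹ (gs ++ᵍ hs)

evalGates-++ᵍ : ∀ {a b c} (gs : Gates a b) (hs : Gates b c) v →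
                evalGates (gs ++ᵍ hs) v ≡ evalGates hs (evalGates gs v)
evalGates-++ᵍ done     hs v = refl
evalGates-++ᵍ (g ▹ gs) hs v = evalGates-++ᵍ gs hs (evalGate g v ∷ v)

infix  4 _⇒_
infixl 3 _▸_

record Compiled (c : ℕ) : Set where
  constructor _⇒_
  field
    {wires} : ℕ
    gates   : Gates c wires
    output  : Fin wires
open Compiled

value : ∀ {c} → Compiled c → Vec Bool c → Bool
value (gs ⇒ o) v = lookup (evalGates gs v) o

-- evalGates puts each new gate in front, so the last gate added is wire zero.
_▸_ : ∀ {c d} → Gates c d → Gate d → Compiled c
gs ▸ g = (gs ++ᵍ (g ▹ done)) ⇒ zero

value-▸ : ∀ {c d} (gs : Gates c d) g v → value (gs ▸ g) v ≡ evalGate g (evalGates gs v)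
value-▸ gs g v = cong (λ u → lookup u zero) (evalGates-++ᵍ gs (g ▹ done) v)

conj : ∀ {c} (r : Compiled c) → Compiled (wires r) → Compiled c
conj (gs ⇒ o) (hs ⇒ o′) = gs ++ᵍ hs ▸ andG (liftWire hs o ∷ o′ ∷ [])

value-conj : ∀ {c} (r : Compiled c) r′ v → value (conj r r′) v ≡ value r v ∧ value r′ (evalGates (gates r) v)
value-conj (gs ⇒ o) (hs ⇒ o′) v = begin
  value (gs ++ᵍ hs ▸ andG (liftWire hs o ∷ o′ ∷ [])) v
    ≡⟨ value-▸ (gs ++ᵍ hs) _ v ⟩
  lookup u (liftWire hs o) ∧ (lookup u o′ ∧ true)
    ≡⟨ cong₂ _∧_ (trans (cong (λ u → lookup u (liftWire hs o)) (evalGates-++ᵍ gs hs v))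
                        (lookup-liftWire hs (evalGates gs v) o))
                 (trans (∧-identityʳ _) (cong (λ u → lookup u o′) (evalGates-++ᵍ gs hs v))) ⟩
  lookup (evalGates gs v) o ∧ lookup (evalGates hs (evalGates gs v)) o′ ∎
  where
  open ≡-Reasoning
  u = evalGates (gs ++ᵍ hs) v

module _ {X : Set} where

  compile : Formula X → ∀ {c} → (X → Fin c) → Compiled c
  compile (input x) ι = done ⇒ ι x
  compile ⊤ᶠ        ι = done ▸ andG []
  compile (¬ᶠ a)    ι = let r = compile a ι in gates r ▸ notG (output r)
  compile (a ∧ᶠ b)  ι = let r = compile a ι in conj r (compile b (liftWire (gates r) ∘ ι))

  compile-correct : ∀ a {c} (ι : X → Fin c) v → value (compile a ι) v ≡ ⟦ a ⟧ (lookup v ∘ ι)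
  compile-correct (input x) ι v = refl
  compile-correct ⊤ᶠ        ι v = refl
  compile-correct (¬ᶠ a)    ι v =
    trans (value-▸ (gates (compile a ι)) _ v) (cong not (compile-correct a ι v))
  compile-correct (a ∧ᶠ b)  ι v =
    trans (value-conj r _ v)
          (cong₂ _∧_ (compile-correct a ι v)
                     (trans (compile-correct b _ (evalGates (gates r) v))
                            (⟦⟧-cong b (lookup-liftWire (gates r) v ∘ ι))))
    where r = compile a ι

  wires-compile : ∀ a {c} (ι : X → Fin c) → wires (compile a ι) ≡ formulaSize a + c
  wires-compile (input x) ι = refl
  wires-compile ⊤ᶠ        ι = refl
  wires-compile (¬ᶠ a)    ι = cong suc (wires-compile a ι)
  wires-compile (a ∧ᶠ b) {c} ι = cong suc (begin
    wires (compile b _)                ≡⟨ wires-compile b _ ⟩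
    formulaSize b + wires (compile a ι) ≡⟨ cong (formulaSize b +_) (wires-compile a ι) ⟩
    formulaSize b + (formulaSize a + c) ≡⟨ normalise (formulaSize a) (formulaSize b) c ⟩
    formulaSize a + formulaSize b + c   ∎)
    where
    open ≡-Reasoning
    normalise : ∀ x y z → y + (x + z) ≡ x + y + z
    normalise = solve-∀

  formulaCircuit : ∀ {m n} → (X → Fin m) → Vec (Formula X) n → Circuit m n
  formulaCircuit ι []       = record { gates = done ; outputs = [] }
  formulaCircuit ι (a ∷ as) = record
    { gates   = gates r ++ᵍ Circuit.gates rs
    ; outputs = liftWire (Circuit.gates rs) (output r) ∷ Circuit.outputs rs
    }
    where
    r  = compile a ι
    rs = formulaCircuit (liftWire (gates r) ∘ ι) as

  evalCircuit-formulaCircuit : ∀ {m n} (ι : X → Fin m) (as : Vec (Formula X) n) x →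
    evalCircuit (formulaCircuit ι as) x ≡ V.map (λ a → ⟦ a ⟧ (lookup x ∘ ι)) as
  evalCircuit-formulaCircuit ι []       x = refl
  evalCircuit-formulaCircuit ι (a ∷ as) x = begin
    V.map (lookup (evalGates (gates r ++ᵍ Circuit.gates rs) x)) (liftWire (Circuit.gates rs) (output r) ∷ Circuit.outputs rs)
      ≡⟨ cong (λ u′ → V.map (lookup u′) (liftWire (Circuit.gates rs) (output r) ∷ Circuit.outputs rs))
              (evalGates-++ᵍ (gates r) (Circuit.gates rs) x) ⟩
    lookup (evalGates (Circuit.gates rs) u) (liftWire (Circuit.gates rs) (output r)) ∷ evalCircuit rs u
      ≡⟨ cong₂ _∷_ (trans (lookup-liftWire (Circuit.gates rs) u (output r)) (compile-correct a ι x))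
                   (trans (evalCircuit-formulaCircuit _ as u)
                          (VP.map-cong (λ b → ⟦⟧-cong b (lookup-liftWire (gates r) x ∘ ι)) as)) ⟩
    ⟦ a ⟧ (lookup x ∘ ι) ∷ V.map (λ b → ⟦ b ⟧ (lookup x ∘ ι)) as ∎
    where
    open ≡-Reasoning
    r  = compile a ι
    rs = formulaCircuit (liftWire (gates r) ∘ ι) as
    u  = evalGates (gates r) x

  circuitSize-formulaCircuit : ∀ {m n} (ι : X → Fin m) (as : Vec (Formula X) n) →
    circuitSize (formulaCircuit ι as) ≡ totalSize as + m
  circuitSize-formulaCircuit ι []           = refl
  circuitSize-formulaCircuit {m} ι (a ∷ as) = begin
    circuitSize (formulaCircuit _ as)        ≡⟨ circuitSize-formulaCircuit _ as ⟩
    totalSize as + wires (compile a ι)       ≡⟨ cong (totalSize as +_) (wires-compile a ι) ⟩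
    totalSize as + (formulaSize a + m)       ≡⟨ normalise (formulaSize a) (totalSize as) m ⟩
    formulaSize a + totalSize as + m         ∎
    where
    open ≡-Reasoning
    normalise : ∀ x y z → y + (x + z) ≡ x + y + z
    normalise = solve-∀

-- Lists, vectors and finite sums

length-insertBy : ∀ {A : Set} (key : A → List Bool) x xs → length (insertBy key x xs) ≡ suc (length xs)
length-insertBy key x []       = refl
length-insertBy key x (y ∷ ys) with lexLeq (key x) (key y)
... | true  = refl
... | false = cong suc (length-insertBy key x ys)

length-sortBy : ∀ {A : Set} (key : A → List Bool) xs → length (sortBy key xs) ≡ length xs
length-sortBy key []       = refl
length-sortBy key (x ∷ xs) = trans (length-insertBy key x (sortBy key xs)) (cong suc (length-sortBy key xs))

nth-just⇒< : ∀ {A : Set} (xs : List A) d {x} → nth xs d ≡ just x → d < length xs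
nth-just⇒< (_ ∷ _)  zero    _  = s≤s z≤n
nth-just⇒< (_ ∷ xs) (suc d) eq = s≤s (nth-just⇒< xs d eq)

lookup-pad-map : ∀ {A B : Set} (f : A → B) z xs {Δ d} (d<Δ : d < Δ) →
                 lookup (pad Δ z (L.map f xs)) (fromℕ< d<Δ) ≡ maybe′ f z (nth xs d)
lookup-pad-map f z []       {d = zero}  (s≤s _)   = refl
lookup-pad-map f z []       {d = suc d} (s≤s d<Δ) = lookup-pad-map f z [] d<Δ
lookup-pad-map f z (x ∷ xs) {d = zero}  (s≤s _)   = refl
lookup-pad-map f z (x ∷ xs) {d = suc d} (s≤s d<Δ) = lookup-pad-map f z xs d<Δ

restrict-++-⊥ : ∀ {k n} (xs : Vec Bool k) (ys : Vec Bool n) s → restrict (xs V.++ ys) (s V.++ ⊥) ≡ restrict xs s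
restrict-++-⊥ []       []       []         = refl
restrict-++-⊥ []       (y ∷ ys) []         = restrict-++-⊥ [] ys []
restrict-++-⊥ (x ∷ xs) ys       (true ∷ s)  = cong (x ∷_) (restrict-++-⊥ xs ys s)
restrict-++-⊥ (x ∷ xs) ys       (false ∷ s) = restrict-++-⊥ xs ys s

++⊆⁻ : ∀ {A : Set} (xs : List A) {ys zs} → xs ++ ys ⊆ zs → xs ⊆ zs × ys ⊆ zs
++⊆⁻ xs ⊆zs = ⊆-trans (xs⊆xs++ys xs _) ⊆zs , ⊆-trans (xs⊆ys++xs _ xs) ⊆zs

∪-++-⊥ : ∀ {m n} (a b : Subset m) → (a V.++ ⊥) ∪ (b V.++ ⊥) ≡ (a ∪ b) V.++ ⊥ {n}
∪-++-⊥ a b = trans (VP.zipWith-++ _∨_ a ⊥ b ⊥) (cong ((a ∪ b) V.++_) (∪-identityʳ ⊥))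

map-tabulate : ∀ {A B : Set} {n} (f : A → B) (g : Fin n → A) {h : Fin n → B} →
               (∀ i → f (g i) ≡ h i) → V.map f (tabulate g) ≡ tabulate h
map-tabulate f g f∘g≗h = trans (sym (VP.tabulate-∘ f g)) (VP.tabulate-cong f∘g≗h)

∑-mono-≤ : ∀ {n} {f g : Fin n → ℕ} → (∀ i → f i ≤ g i) → sum f ≤ sum g
∑-mono-≤ {zero}  f≤g = z≤n
∑-mono-≤ {suc n} f≤g = +-mono-≤ (f≤g zero) (∑-mono-≤ (f≤g ∘ suc))

∑-1 : ∀ n → ∑[ i < n ] 1 ≡ n
∑-1 zero    = refl
∑-1 (suc n) = cong suc (∑-1 n)

foldr-+-toList : ∀ {A : Set} {n} (f : A → ℕ) (xs : Vec A n) →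
                 L.foldr _+_ 0 (L.map f (V.toList xs)) ≡ ∑[ i < n ] f (lookup xs i)
foldr-+-toList f []       = refl
foldr-+-toList f (x ∷ xs) = cong (f x +_) (foldr-+-toList f xs)

-- Schemata as formulas

props : ∀ {p k} → Schema p k → List (Fin p)
props ⊤ˢ       = []
props (prop j) = j ∷ []
props (var _)  = []
props (¬ˢ φ)   = props φ
props (φ ∧ˢ ψ) = props φ ++ props ψ
props (◇ _ φ)  = props φ

length-props≤schemaSize : ∀ {p k} (φ : Schema p k) → length (props φ) ≤ schemaSize φ
length-props≤schemaSize ⊤ˢ       = z≤n
length-props≤schemaSize (prop _) = ≤-refl
length-props≤schemaSize (var _)  = z≤n
length-props≤schemaSize (¬ˢ φ)   = m≤n⇒m≤1+n (length-props≤schemaSize φ)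
length-props≤schemaSize (φ ∧ˢ ψ) = m≤n⇒m≤1+n (begin
  length (props φ ++ props ψ)           ≡⟨ LP.length-++ (props φ) ⟩
  length (props φ) + length (props ψ)   ≤⟨ +-mono-≤ (length-props≤schemaSize φ) (length-props≤schemaSize ψ) ⟩
  schemaSize φ + schemaSize ψ           ∎)
  where open ≤-Reasoning
length-props≤schemaSize (◇ _ φ)  = m≤n⇒m≤1+n (length-props≤schemaSize φ)

1≤schemaSize : ∀ {p k} (φ : Schema p k) → 1 ≤ schemaSize φ
1≤schemaSize ⊤ˢ       = s≤s z≤n
1≤schemaSize (prop _) = s≤s z≤n
1≤schemaSize (var _)  = s≤s z≤n
1≤schemaSize (¬ˢ _)   = s≤s z≤n
1≤schemaSize (_ ∧ˢ _) = s≤s z≤n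
1≤schemaSize (◇ _ _)  = s≤s z≤n

translate : ∀ {p k} {X : Set} → (Fin p → Formula X) → (Fin k → Formula X) →
            (ℕ → Schema p k → Formula X) → Schema p k → Formula X
translate P Y D ⊤ˢ       = ⊤ᶠ
translate P Y D (prop j) = P j
translate P Y D (var j)  = Y j
translate P Y D (¬ˢ φ)   = ¬ᶠ translate P Y D φ
translate P Y D (φ ∧ˢ ψ) = translate P Y D φ ∧ᶠ translate P Y D ψ
translate P Y D (◇ d φ)  = D d φ

formulaSize-translate : ∀ {p k} {X : Set} {P : Fin p → Formula X} {Y : Fin k → Formula X} {D} →
  (∀ j → formulaSize (P j) ≤ 1) → (∀ j → formulaSize (Y j) ≤ 1) →
  (∀ d φ → formulaSize (D d φ) ≤ suc (schemaSize φ)) →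
  ∀ φ → formulaSize (translate P Y D φ) ≤ schemaSize φ
formulaSize-translate P≤ Y≤ D≤ ⊤ˢ       = ≤-refl
formulaSize-translate P≤ Y≤ D≤ (prop j) = P≤ j
formulaSize-translate P≤ Y≤ D≤ (var j)  = Y≤ j
formulaSize-translate P≤ Y≤ D≤ (¬ˢ φ)   = s≤s (formulaSize-translate P≤ Y≤ D≤ φ)
formulaSize-translate P≤ Y≤ D≤ (φ ∧ˢ ψ) =
  s≤s (+-mono-≤ (formulaSize-translate P≤ Y≤ D≤ φ) (formulaSize-translate P≤ Y≤ D≤ ψ))
formulaSize-translate P≤ Y≤ D≤ (◇ d φ)  = D≤ d φ

module _ (isId : ℕ → Bool) {Π : List ℕ} (M : Kripke Π) {k : ℕ} {X : Set}
         {ρ : X → Bool} {e : W M → Fin k → Bool} {v : W M} where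
  open Kripke M using (V)

  translate-correct : ∀ {P Y D} φ → modalDepth φ ≤ 0 →
    (∀ {j} → j ∈ props φ → ⟦ P j ⟧ ρ ≡ V j v) → (∀ j → ⟦ Y j ⟧ ρ ≡ e v j) →
    ⟦ translate P Y D φ ⟧ ρ ≡ holds isId M e φ v
  translate-correct ⊤ˢ       _ P-ok Y-ok = refl
  translate-correct (prop j) _ P-ok Y-ok = P-ok (here refl)
  translate-correct (var j)  _ P-ok Y-ok = Y-ok j
  translate-correct (¬ˢ φ)   d P-ok Y-ok = cong not (translate-correct φ d P-ok Y-ok)
  translate-correct (φ ∧ˢ ψ) d P-ok Y-ok = cong₂ _∧_
    (translate-correct φ (m⊔n≤o⇒m≤o (modalDepth φ) _ d) (P-ok ∘ xs⊆xs++ys _ _) Y-ok)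
    (translate-correct ψ (m⊔n≤o⇒n≤o (modalDepth φ) _ d) (P-ok ∘ xs⊆ys++xs _ _) Y-ok)
  translate-correct (◇ _ _)  () _ _

Branch : ℕ → ℕ → Set
Branch p k = Schema p k × Schema p k

branchProps : ∀ {p k} → Branch p k → List (Branch p k) → Schema p k → List (Fin p)
branchProps (φ , ψ) []       χ = props φ ++ props ψ ++ props χ
branchProps (φ , ψ) (b ∷ bs) χ = props φ ++ props ψ ++ branchProps b bs χ

clauseProps : ∀ {p k} → Clause p k → List (Fin p)
clauseProps (std ψ)               = props ψ
clauseProps (cond (b L⁺.∷ bs) χ) = branchProps b bs χ

length-++³≤ : ∀ {A : Set} (xs ys zs : List A) {a b c} →
  length xs ≤ a → length ys ≤ b → length zs ≤ c → length (xs ++ ys ++ zs) ≤ a + b + c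
length-++³≤ xs ys zs {a} {b} {c} xs≤ ys≤ zs≤ = begin
  length (xs ++ ys ++ zs)                   ≡⟨ LP.length-++ xs ⟩
  length xs + length (ys ++ zs)             ≡⟨ cong (length xs +_) (LP.length-++ ys) ⟩
  length xs + (length ys + length zs)       ≤⟨ +-mono-≤ xs≤ (+-mono-≤ ys≤ zs≤) ⟩
  a + (b + c)                               ≡⟨ +-assoc a b c ⟨
  a + b + c                                 ∎
  where open ≤-Reasoning

length-branchProps : ∀ {p k} (b : Branch p k) bs χ → length (branchProps b bs χ) ≤ clauseSize (cond (b L⁺.∷ bs) χ)
length-branchProps (φ , ψ) []       χ =
  length-++³≤ (props φ) (props ψ) (props χ)
    (length-props≤schemaSize φ) (length-props≤schemaSize ψ) (length-props≤schemaSize χ)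
length-branchProps (φ , ψ) (b ∷ bs) χ =
  length-++³≤ (props φ) (props ψ) (branchProps b bs χ)
    (length-props≤schemaSize φ) (length-props≤schemaSize ψ) (length-branchProps b bs χ)

length-clauseProps : ∀ {p k} (c : Clause p k) → length (clauseProps c) ≤ clauseSize c
length-clauseProps (std ψ)               = length-props≤schemaSize ψ
length-clauseProps (cond (b L⁺.∷ bs) χ) = length-branchProps b bs χ

clausesProps : ∀ {p k m} → Vec (Clause p k) m → List (Fin p)
clausesProps []       = []
clausesProps (c ∷ cs) = clauseProps c ++ clausesProps cs

clauseProps⊆clausesProps : ∀ {p k m} (cs : Vec (Clause p k) m) i → clauseProps (lookup cs i) ⊆ clausesProps cs
clauseProps⊆clausesProps (c ∷ cs) zero    = xs⊆xs++ys _ _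
clauseProps⊆clausesProps (c ∷ cs) (suc i) = ⊆-trans (clauseProps⊆clausesProps cs i) (xs⊆ys++xs _ _)

length-clausesProps : ∀ {p k m} (cs : Vec (Clause p k) m) →
  length (clausesProps cs) ≡ ∑[ i < m ] length (clauseProps (lookup cs i))
length-clausesProps []       = refl
length-clausesProps (c ∷ cs) = trans (LP.length-++ (clauseProps c)) (cong (length (clauseProps c) +_) (length-clausesProps cs))

-- The message passing circuit of a program

module Construction (isId : ℕ → Bool) (Π : List ℕ) (Δ : ℕ) (Prog : Program (length Π)) where
  open Program Prog
  open import Data.List.Membership.DecPropositional (Data.Fin._≟_ {length Π}) using (_∈?_)

  p : ℕ
  p = length Π

  used : List (Fin p)
  used = clausesProps iteration

  -- One flag per head, rather than a single one, keeps the width within the program size when k = 0.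
  width : ℕ
  width = k + (k + length used)

  valueBit flagBit : Fin k → Fin width
  valueBit j = j ↑ˡ (k + length used)
  flagBit  i = k ↑ʳ (i ↑ˡ length used)

  copyBit : Fin (length used) → Fin width
  copyBit t = k ↑ʳ (k ↑ʳ t)

  data Input : Set where
    local : Fin p → Input
    slot  : Fin (suc Δ) → Fin width → Input

  position : Input → Fin (p + suc Δ * width)
  position (local j)  = j ↑ˡ (suc Δ * width)
  position (slot s b) = p ↑ʳ combine s b

  copyOf : Fin (suc Δ) → Fin p → Formula Input
  copyOf s j with j ∈? used
  ... | yes j∈used = input (slot s (copyBit (index j∈used)))
  ... | no  _      = ⊤ᶠ  -- never read: clauses only use propositions in used

  -- Schemata evaluated at a neighbour have modal depth 0, so their diamonds are never translated.
  atSlot : Fin (suc Δ) → Schema p k → Formula Input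
  atSlot s = translate (copyOf s) (input ∘ slot s ∘ valueBit) (λ _ _ → ⊤ᶠ)

  diamond : Fin k → (d : ℕ) → Schema p k → Dec (d < Δ) → Formula Input
  diamond i d φ (yes d<Δ) = input (slot s (flagBit i)) ∧ᶠ atSlot s φ
    where s = suc (fromℕ< d<Δ)
  diamond i d φ (no _)    = ⊥ᶠ

  atNode : Fin k → Schema p k → Formula Input
  atNode i = translate (input ∘ local) (input ∘ slot zero ∘ valueBit) (λ d φ → diamond i d φ (d <? Δ))

  branchFormula : Fin k → Branch p k → List (Branch p k) → Schema p k → Formula Input
  branchFormula i (φ , ψ) []       χ = ifᶠ atNode i φ then atNode i ψ else atNode i χ
  branchFormula i (φ , ψ) (b ∷ bs) χ = ifᶠ atNode i φ then atNode i ψ else branchFormula i b bs χ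

  clauseFormula : Fin k → Clause p k → Formula Input
  clauseFormula i (std ψ)               = atNode i ψ
  clauseFormula i (cond (b L⁺.∷ bs) χ) = branchFormula i b bs χ

  terminalFormula : Schema p 0 → Formula Input
  terminalFormula = translate (input ∘ local) (λ ()) (λ _ _ → ⊤ᶠ)

  nextFormula : Fin k → Formula Input
  nextFormula i = ifᶠ input (slot zero (flagBit i))
                  then clauseFormula i (lookup iteration i)
                  else terminalFormula (lookup terminal i)

  flagFormulas : Vec (Formula Input) k
  flagFormulas = tabulate (λ _ → ⊤ᶠ)

  copyFormulas : Vec (Formula Input) (length used)
  copyFormulas = tabulate (input ∘ local ∘ L.lookup used)

  outputFormulas : Vec (Formula Input) width
  outputFormulas = tabulate nextFormula V.++ (flagFormulas V.++ copyFormulas)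

  mpc : MPC Π Δ
  mpc = record
    { k = width
    ; C = formulaCircuit position outputFormulas
    ; A = attention V.++ ⊥
    ; P = print V.++ ⊥
    }

  module Semantics (M : Kripke Π) where
    open Kripke M using (V)

    cfg : ℕ → W M → Fin k → Bool
    cfg = config isId M Prog

    nbrs : W M → List (W M)
    nbrs = neighbours isId M

    flags : Vec Bool k
    flags = tabulate (λ _ → true)

    copies : W M → Vec Bool (length used)
    copies w = tabulate (λ t → V (L.lookup used t) w)

    encode : ℕ → W M → Vec Bool width
    encode n w = tabulate (cfg n w) V.++ (flags V.++ copies w)

    silent : Vec Bool width
    silent = replicate width false

    received : ℕ → W M → Vec (Vec Bool width) (suc Δ)
    received n w = encode n w ∷ pad Δ silent (L.map (encode n) (nbrs w))

    lookup-encode-value : ∀ n w j → lookup (encode n w) (valueBit j) ≡ cfg n w j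
    lookup-encode-value n w j = trans (VP.lookup-++ˡ (tabulate (cfg n w)) _ j) (VP.lookup∘tabulate (cfg n w) j)

    lookup-encode-flag : ∀ n w i → lookup (encode n w) (flagBit i) ≡ true
    lookup-encode-flag n w i = begin
      lookup (encode n w) (flagBit i) ≡⟨ VP.lookup-++ʳ (tabulate (cfg n w)) _ (i ↑ˡ length used) ⟩
      lookup (flags V.++ copies w) (i ↑ˡ length used) ≡⟨ VP.lookup-++ˡ flags (copies w) i ⟩
      lookup flags i ≡⟨ VP.lookup∘tabulate _ i ⟩
      true ∎
      where open ≡-Reasoning

    lookup-encode-copy : ∀ n w t → lookup (encode n w) (copyBit t) ≡ V (L.lookup used t) w
    lookup-encode-copy n w t = begin
      lookup (encode n w) (copyBit t) ≡⟨ VP.lookup-++ʳ (tabulate (cfg n w)) _ (k ↑ʳ t) ⟩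
      lookup (flags V.++ copies w) (k ↑ʳ t) ≡⟨ VP.lookup-++ʳ flags (copies w) t ⟩
      lookup (copies w) t ≡⟨ VP.lookup∘tabulate _ t ⟩
      V (L.lookup used t) w ∎
      where open ≡-Reasoning

    module _ {n : ℕ} {w : W M} (deg : length (nbrs w) ≤ Δ) {ρ : Input → Bool}
             (reads-local : ∀ j → ρ (local j) ≡ V j w)
             (reads-slot : ∀ s b → ρ (slot s b) ≡ lookup (lookup (received n w) s) b) where

      reads-encode : ∀ {s v} → lookup (received n w) s ≡ encode n v → ∀ b → ρ (slot s b) ≡ lookup (encode n v) b
      reads-encode {s} eq b = trans (reads-slot s b) (cong (λ m → lookup m b) eq)

      copyOf-correct : ∀ {s v} → lookup (received n w) s ≡ encode n v →
                       ∀ {j} → j ∈ used → ⟦ copyOf s j ⟧ ρ ≡ V j v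
      copyOf-correct {s} {v} eq {j} j∈ with j ∈? used
      ... | yes j∈used = begin
        ρ (slot s (copyBit (index j∈used)))       ≡⟨ reads-encode eq _ ⟩
        lookup (encode n v) (copyBit (index j∈used)) ≡⟨ lookup-encode-copy n v (index j∈used) ⟩
        V (L.lookup used (index j∈used)) v          ≡⟨ cong (λ j′ → V j′ v) (lookup-index j∈used) ⟨
        V j v                                       ∎
        where open ≡-Reasoning
      ... | no  j∉used = ⊥-elim (j∉used j∈)

      atSlot-correct : ∀ {s v} → lookup (received n w) s ≡ encode n v →
                       ∀ φ → modalDepth φ ≤ 0 → props φ ⊆ used →
                       ⟦ atSlot s φ ⟧ ρ ≡ holds isId M (cfg n) φ v
      atSlot-correct {s} {v} eq φ φ₀ φ⊆ = translate-correct isId M φ φ₀ (copyOf-correct eq ∘ φ⊆)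
        (λ j → trans (reads-encode eq (valueBit j)) (lookup-encode-value n v j))

      received-neighbour : ∀ {d} (d<Δ : d < Δ) →
        lookup (received n w) (suc (fromℕ< d<Δ)) ≡ maybe′ (encode n) silent (nth (nbrs w) d)
      received-neighbour = lookup-pad-map (encode n) silent (nbrs w)

      diamond-correct : ∀ i d φ → modalDepth φ ≤ 0 → props φ ⊆ used → (d<?Δ : Dec (d < Δ)) →
                        ⟦ diamond i d φ d<?Δ ⟧ ρ ≡ holds isId M (cfg n) (◇ d φ) w
      diamond-correct i d φ φ₀ φ⊆ d<?Δ with nth (nbrs w) d in eq | d<?Δ
      ... | just v  | yes d<Δ = cong₂ _∧_
            (trans (reads-encode here-v (flagBit i)) (lookup-encode-flag n v i))
            (atSlot-correct here-v φ φ₀ φ⊆)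
        where
        here-v : lookup (received n w) (suc (fromℕ< d<Δ)) ≡ encode n v
        here-v = trans (received-neighbour d<Δ) (cong (maybe′ (encode n) silent) eq)
      ... | just v  | no  d≮Δ = ⊥-elim (d≮Δ (<-≤-trans (nth-just⇒< (nbrs w) d eq) deg))
      ... | nothing | yes d<Δ = cong (_∧ ⟦ atSlot (suc (fromℕ< d<Δ)) φ ⟧ ρ) (begin
            ρ (slot (suc (fromℕ< d<Δ)) (flagBit i)) ≡⟨ reads-slot _ (flagBit i) ⟩
            lookup (lookup (received n w) (suc (fromℕ< d<Δ))) (flagBit i)
              ≡⟨ cong (λ m → lookup m (flagBit i)) (trans (received-neighbour d<Δ) (cong (maybe′ (encode n) silent) eq)) ⟩
            lookup silent (flagBit i) ≡⟨ VP.lookup-replicate (flagBit i) false ⟩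
            false ∎)
        where open ≡-Reasoning
      ... | nothing | no  _    = refl

      atNode-correct : ∀ i φ → modalDepth φ ≤ 1 → props φ ⊆ used →
                       ⟦ atNode i φ ⟧ ρ ≡ holds isId M (cfg n) φ w
      atNode-correct i ⊤ˢ       _  _  = refl
      atNode-correct i (prop j) _  _  = reads-local j
      atNode-correct i (var j)  _  _  = trans (reads-slot zero (valueBit j)) (lookup-encode-value n w j)
      atNode-correct i (¬ˢ φ)   φ₁ φ⊆ = cong not (atNode-correct i φ φ₁ φ⊆)
      atNode-correct i (φ ∧ˢ ψ) d  ⊆u = let φ⊆ , ψ⊆ = ++⊆⁻ (props φ) ⊆u in cong₂ _∧_
        (atNode-correct i φ (m⊔n≤o⇒m≤o (modalDepth φ) _ d) φ⊆)
        (atNode-correct i ψ (m⊔n≤o⇒n≤o (modalDepth φ) _ d) ψ⊆)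
      atNode-correct i (◇ d φ)  φ₁ φ⊆ = diamond-correct i d φ (s≤s⁻¹ φ₁) φ⊆ (d <? Δ)

      branchFormula-correct : ∀ i b bs χ → WFClause (cond (b L⁺.∷ bs) χ) → branchProps b bs χ ⊆ used →
        ⟦ branchFormula i b bs χ ⟧ ρ ≡ holdsCond isId M (cfg n) (b ∷ bs) χ w
      branchFormula-correct i (φ , ψ) [] χ ((φ₀ , ψ₁) , χ₁) ⊆u =
        let φ⊆ , ψχ⊆ = ++⊆⁻ (props φ) ⊆u ; ψ⊆ , χ⊆ = ++⊆⁻ (props ψ) ψχ⊆ in
        ⟦ifᶠ⟧ (atNode i φ) (atNode i ψ) (atNode i χ) ρ
          (atNode-correct i φ (≤-trans (≤-reflexive φ₀) z≤n) φ⊆) (atNode-correct i ψ ψ₁ ψ⊆)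
          (atNode-correct i χ χ₁ χ⊆)
      branchFormula-correct i (φ , ψ) (b ∷ bs) χ ((φ₀ , ψ₁) , rest) ⊆u =
        let φ⊆ , ψχ⊆ = ++⊆⁻ (props φ) ⊆u ; ψ⊆ , χ⊆ = ++⊆⁻ (props ψ) ψχ⊆ in
        ⟦ifᶠ⟧ (atNode i φ) (atNode i ψ) (branchFormula i b bs χ) ρ
          (atNode-correct i φ (≤-trans (≤-reflexive φ₀) z≤n) φ⊆) (atNode-correct i ψ ψ₁ ψ⊆)
          (branchFormula-correct i b bs χ rest χ⊆)

      clauseFormula-correct : ∀ i c → WFClause c → clauseProps c ⊆ used →
        ⟦ clauseFormula i c ⟧ ρ ≡ holdsClause isId M (cfg n) c w
      clauseFormula-correct i (std ψ)               = atNode-correct i ψ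
      clauseFormula-correct i (cond (b L⁺.∷ bs) χ) = branchFormula-correct i b bs χ

    terminalFormula-correct : ∀ {w} {ρ : Input → Bool} → (∀ j → ρ (local j) ≡ V j w) →
      ∀ φ → modalDepth φ ≡ 0 → ⟦ terminalFormula φ ⟧ ρ ≡ holds isId M (noVars isId M) φ w
    terminalFormula-correct reads-local φ φ₀ =
      translate-correct isId M φ (≤-reflexive φ₀) (λ {j} _ → reads-local j) (λ ())

    lookup-position-local : ∀ w (r : Vec Bool (suc Δ * width)) j →
      lookup (localInput isId M w V.++ r) (position (local j)) ≡ V j w
    lookup-position-local w r j = trans (VP.lookup-++ˡ (localInput isId M w) r j) (VP.lookup∘tabulate _ j)

    lookup-position-slot : ∀ (l : Vec Bool p) r s b → lookup (l V.++ r) (position (slot s b)) ≡ lookup r (combine s b)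
    lookup-position-slot l r s b = VP.lookup-++ʳ l r (combine s b)

    map-⟦outputFormulas⟧ : ∀ n w {ρ : Input → Bool} → (∀ i → ⟦ nextFormula i ⟧ ρ ≡ cfg n w i) →
      (∀ j → ρ (local j) ≡ V j w) → V.map (λ a → ⟦ a ⟧ ρ) outputFormulas ≡ encode n w
    map-⟦outputFormulas⟧ n w {ρ} next-ok reads-local = begin
      V.map ⟦_⟧ρ (tabulate nextFormula V.++ (flagFormulas V.++ copyFormulas))
        ≡⟨ VP.map-++ ⟦_⟧ρ (tabulate nextFormula) _ ⟩
      V.map ⟦_⟧ρ (tabulate nextFormula) V.++ V.map ⟦_⟧ρ (flagFormulas V.++ copyFormulas)
        ≡⟨ cong (V.map ⟦_⟧ρ (tabulate nextFormula) V.++_) (VP.map-++ ⟦_⟧ρ flagFormulas copyFormulas) ⟩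
      V.map ⟦_⟧ρ (tabulate nextFormula) V.++ (V.map ⟦_⟧ρ flagFormulas V.++ V.map ⟦_⟧ρ copyFormulas)
        ≡⟨ cong₂ V._++_ (map-tabulate ⟦_⟧ρ nextFormula next-ok)
                        (cong₂ V._++_ (map-tabulate ⟦_⟧ρ _ (λ _ → refl))
                                      (map-tabulate ⟦_⟧ρ _ (reads-local ∘ L.lookup used))) ⟩
      encode n w ∎
      where
      open ≡-Reasoning
      ⟦_⟧ρ : Formula Input → Bool
      ⟦ a ⟧ρ = ⟦ a ⟧ ρ

    evalCircuit-encode : ∀ n w (r : Vec Bool (suc Δ * width)) →
      (∀ i → ⟦ nextFormula i ⟧ (lookup (localInput isId M w V.++ r) ∘ position) ≡ cfg n w i) →
      evalCircuit (MPC.C mpc) (localInput isId M w V.++ r) ≡ encode n w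
    evalCircuit-encode n w r next-ok =
      trans (evalCircuit-formulaCircuit position outputFormulas _)
            (map-⟦outputFormulas⟧ n w next-ok (lookup-position-local w r))

    mpcState≡encode : (∀ w → length (nbrs w) ≤ Δ) → ∀ n w → mpcState isId mpc M n w ≡ encode n w
    mpcState≡encode deg zero w = evalCircuit-encode zero w zeros λ i →
      ⟦ifᶠ⟧ (input (slot zero (flagBit i))) (clauseFormula i (lookup iteration i)) (terminalFormula (lookup terminal i))
        (lookup (localInput isId M w V.++ zeros) ∘ position)
        (trans (lookup-position-slot (localInput isId M w) zeros zero (flagBit i))
               (VP.lookup-replicate (combine {suc Δ} zero (flagBit i)) false))
        refl
        (terminalFormula-correct (lookup-position-local w zeros) (lookup terminal i) (terminalWF i))
      where
      zeros = replicate (suc Δ * width) false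
    mpcState≡encode deg (suc n) w =
      trans (cong (λ ms → evalCircuit (MPC.C mpc) (localInput isId M w V.++ concat ms)) received≡)
      (evalCircuit-encode (suc n) w messages λ i →
        ⟦ifᶠ⟧ (input (slot zero (flagBit i))) (clauseFormula i (lookup iteration i)) (terminalFormula (lookup terminal i))
          (lookup (localInput isId M w V.++ messages) ∘ position)
          (trans (reads-slot zero (flagBit i)) (lookup-encode-flag n w i))
          (clauseFormula-correct {n = n} (deg w) (lookup-position-local w messages) reads-slot i (lookup iteration i)
            (iterationWF i) (clauseProps⊆clausesProps iteration i))
          refl)
      where
      messages = concat (received n w)
      received≡ : mpcState isId mpc M n w ∷ pad Δ silent (L.map (mpcState isId mpc M n) (nbrs w)) ≡ received n w
      received≡ = cong₂ (λ m ms → m ∷ pad Δ silent ms)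
                        (mpcState≡encode deg n w) (LP.map-cong (mpcState≡encode deg n) (nbrs w))
      reads-slot : ∀ s b → lookup (localInput isId M w V.++ messages) (position (slot s b))
                           ≡ lookup (lookup (received n w) s) b
      reads-slot s b = trans (lookup-position-slot (localInput isId M w) messages s b)
                             (VP.lookup-concat (received n w) s b)

  strongly-equivalent : StronglyEquivalent isId Π Δ Prog mpc
  strongly-equivalent M (_ , outdeg) w n = begin
    restrict (tabulate (cfg n w)) (attention ∪ print)
      ≡⟨ restrict-++-⊥ (tabulate (cfg n w)) (flags V.++ copies w) (attention ∪ print) ⟨
    restrict (encode n w) ((attention ∪ print) V.++ ⊥)
      ≡⟨ cong₂ restrict (mpcState≡encode deg n w) (∪-++-⊥ attention print) ⟨
    restrict (mpcState isId mpc M n w) ((attention V.++ ⊥) ∪ (print V.++ ⊥)) ∎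
    where
    open ≡-Reasoning
    open Semantics M
    deg : ∀ w → length (nbrs w) ≤ Δ
    deg w = subst (_≤ Δ) (sym (length-sortBy (ID isId M) (successors isId M w))) (outdeg w)

  headSize : Fin k → ℕ
  headSize i = suc (schemaSize (lookup terminal i)) + suc (clauseSize (lookup iteration i))

  programSize≡∑headSize : programSize Prog ≡ ∑[ i < k ] headSize i
  programSize≡∑headSize =
    trans (cong₂ _+_ (foldr-+-toList _ terminal) (foldr-+-toList _ iteration))
          (sym (∑-distrib-+ (suc ∘ schemaSize ∘ lookup terminal) (suc ∘ clauseSize ∘ lookup iteration)))

  copyOf-size : ∀ s j → formulaSize (copyOf s j) ≤ 1
  copyOf-size s j with j ∈? used
  ... | yes _ = z≤n
  ... | no  _ = ≤-refl

  diamond-size : ∀ i d φ (d<?Δ : Dec (d < Δ)) → formulaSize (diamond i d φ d<?Δ) ≤ suc (schemaSize φ)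
  diamond-size i d φ (yes _) = s≤s (formulaSize-translate (copyOf-size _) (λ _ → z≤n) (λ _ _ → s≤s z≤n) φ)
  diamond-size i d φ (no _)  = s≤s (1≤schemaSize φ)

  atNode-size : ∀ i φ → formulaSize (atNode i φ) ≤ schemaSize φ
  atNode-size i = formulaSize-translate (λ _ → z≤n) (λ _ → z≤n) (λ d φ → diamond-size i d φ (d <? Δ))

  branchFormula-size : ∀ i b bs χ → formulaSize (branchFormula i b bs χ) ≤ 9 * clauseSize (cond (b L⁺.∷ bs) χ)
  branchFormula-size i (φ , ψ) []       χ = formulaSize-ifᶠ≤ (atNode i φ) (atNode i ψ) (atNode i χ)
    (1≤schemaSize φ) (atNode-size i φ) (atNode-size i ψ) (≤-trans (atNode-size i χ) (m≤n*m _ 9))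
  branchFormula-size i (φ , ψ) (b ∷ bs) χ = formulaSize-ifᶠ≤ (atNode i φ) (atNode i ψ) (branchFormula i b bs χ)
    (1≤schemaSize φ) (atNode-size i φ) (atNode-size i ψ) (branchFormula-size i b bs χ)

  clauseFormula-size : ∀ i c → formulaSize (clauseFormula i c) ≤ 9 * clauseSize c
  clauseFormula-size i (std ψ)               = ≤-trans (atNode-size i ψ) (m≤n*m _ 9)
  clauseFormula-size i (cond (b L⁺.∷ bs) χ) = branchFormula-size i b bs χ

  nextFormula-size : ∀ i → formulaSize (nextFormula i) + 1 ≤ 9 * headSize i
  nextFormula-size i = begin
    formulaSize (nextFormula i) + 1
      ≡⟨ cong (_+ 1) (formulaSize-ifᶠ (input (slot zero (flagBit i))) clause term) ⟩
    7 + 2 * 0 + formulaSize clause + formulaSize term + 1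
      ≤⟨ +-monoˡ-≤ 1 (+-mono-≤ (+-monoʳ-≤ (7 + 2 * 0) (clauseFormula-size i (lookup iteration i)))
                               (formulaSize-translate (λ _ → z≤n) (λ ()) (λ _ _ → s≤s z≤n) (lookup terminal i))) ⟩
    7 + 2 * 0 + 9 * cs + ts + 1                        ≤⟨ m≤m+n _ (10 + 8 * ts) ⟩
    7 + 2 * 0 + 9 * cs + ts + 1 + (10 + 8 * ts)        ≡⟨ normalise cs ts ⟩
    9 * headSize i                                     ∎
    where
    open ≤-Reasoning
    clause = clauseFormula i (lookup iteration i)
    term   = terminalFormula (lookup terminal i)
    cs = clauseSize (lookup iteration i)
    ts = schemaSize (lookup terminal i)
    normalise : ∀ cs ts → 7 + 2 * 0 + 9 * cs + ts + 1 + (10 + 8 * ts) ≡ 9 * (suc ts + suc cs)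
    normalise = solve-∀

  outputFormulas-size : totalSize outputFormulas ≤ 9 * programSize Prog
  outputFormulas-size = begin
    totalSize (tabulate nextFormula V.++ (flagFormulas V.++ copyFormulas))
      ≡⟨ trans (totalSize-++ (tabulate nextFormula) _)
               (cong (totalSize (tabulate nextFormula) +_) (totalSize-++ flagFormulas _)) ⟩
    totalSize (tabulate nextFormula) + (totalSize flagFormulas + totalSize copyFormulas)
      ≡⟨ cong₂ _+_ (totalSize-tabulate nextFormula)
                   (cong₂ _+_ (totalSize-tabulate {n = k} (λ _ → ⊤ᶠ))
                              (trans (totalSize-tabulate (input ∘ local ∘ L.lookup used))
                                     (sum-replicate-zero (length used)))) ⟩
    ∑[ i < k ] formulaSize (nextFormula i) + (∑[ i < k ] 1 + 0)
      ≡⟨ cong (∑[ i < k ] formulaSize (nextFormula i) +_) (+-identityʳ _) ⟩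
    ∑[ i < k ] formulaSize (nextFormula i) + ∑[ i < k ] 1
      ≡⟨ ∑-distrib-+ (formulaSize ∘ nextFormula) (λ _ → 1) ⟨
    ∑[ i < k ] (formulaSize (nextFormula i) + 1)      ≤⟨ ∑-mono-≤ nextFormula-size ⟩
    ∑[ i < k ] (9 * headSize i)                       ≡⟨ *-distribˡ-sum 9 headSize ⟨
    9 * ∑[ i < k ] headSize i                         ≡⟨ cong (9 *_) programSize≡∑headSize ⟨
    9 * programSize Prog                              ∎
    where open ≤-Reasoning

  width≤programSize : width ≤ programSize Prog
  width≤programSize = begin
    k + (k + length used)
      ≡⟨ cong₂ _+_ (sym (∑-1 k)) (cong₂ _+_ (sym (∑-1 k)) (length-clausesProps iteration)) ⟩
    ∑[ i < k ] 1 + (∑[ i < k ] 1 + ∑[ i < k ] length (clauseProps (lookup iteration i)))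
      ≡⟨ trans (cong (∑[ i < k ] 1 +_) (sym (∑-distrib-+ (λ _ → 1) props-len)))
               (sym (∑-distrib-+ (λ _ → 1) (suc ∘ props-len))) ⟩
    ∑[ i < k ] suc (suc (length (clauseProps (lookup iteration i))))
      ≤⟨ ∑-mono-≤ (λ i → s≤s (≤-trans (s≤s (length-clauseProps (lookup iteration i))) (m≤n+m _ _))) ⟩
    ∑[ i < k ] headSize i ≡⟨ programSize≡∑headSize ⟨
    programSize Prog ∎
    where
    open ≤-Reasoning
    props-len : Fin k → ℕ
    props-len i = length (clauseProps (lookup iteration i))

  circuitSize-mpc : circuitSize (MPC.C mpc) ≤ 10 * (suc Δ * programSize Prog + p)
  circuitSize-mpc = begin
    circuitSize (formulaCircuit position outputFormulas)        ≡⟨ circuitSize-formulaCircuit position outputFormulas ⟩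
    totalSize outputFormulas + (p + suc Δ * width)
      ≤⟨ +-mono-≤ outputFormulas-size (+-monoʳ-≤ p (*-monoʳ-≤ (suc Δ) width≤programSize)) ⟩
    9 * m + (p + suc Δ * m)                 ≤⟨ +-monoˡ-≤ (p + suc Δ * m) (*-monoʳ-≤ 9 (m≤n*m m (suc Δ))) ⟩
    9 * (suc Δ * m) + (p + suc Δ * m)       ≤⟨ m≤m+n _ (9 * p) ⟩
    9 * (suc Δ * m) + (p + suc Δ * m) + 9 * p ≡⟨ normalise (suc Δ * m) p ⟩
    10 * (suc Δ * m + p)                    ∎
    where
    open ≤-Reasoning
    m = programSize Prog
    normalise : ∀ x p → 9 * x + (p + x) + 9 * p ≡ 10 * (x + p)
    normalise = solve-∀

theorem2 : Σ ℕ λ c →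
    (isId : ℕ → Bool) →
    (∀ n → Σ ℕ λ s → n ≤ s × isId s ≡ true) →
    (∀ n → Σ ℕ λ s → n ≤ s × isId s ≡ false) →
    (Π : List ℕ) → Linked _<_ Π →
    (Δ : ℕ) → (P : Program (length Π)) →
    Σ (MPC Π Δ) λ N →
      circuitSize (MPC.C N) ≤ c * (suc Δ * programSize P + length Π)
      × StronglyEquivalent isId Π Δ P N
theorem2 = 10 , λ isId _ _ Π _ Δ P → let open Construction isId Π Δ P in mpc , circuitSize-mpc , strongly-equivalent
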